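{- Let $G$ be a connected graph of order $n\ge 2$. (i) For every integer $t\ge 2$, $\dim_l(G\odot K_t)=n(t-1)$. (ii) For all positive integers $r,s$, $\dim_l(G\odot K_{r,s})=n$. (iii) For every integer $t\ge 4$: if $t\equiv 1\pmod 4$ then $\dim_l(G\odot P_t)=n\lfloor t/4\rfloor$, and if $t\not\equiv 1\pmod 4$ then $\dim_l(G\odot P_t)=n\lceil t/4\rceil$. (iv) For every integer $t\ge 4$, $\dim_l(G\odot C_t)=n\lceil t/4\rceil$.
   Context: All graphs are finite and simple. For a connected graph $X$, $d_X(x,y)$ is the length of a shortest path between $x$ and $y$. A vertex $w$ distinguishes two vertices $x,y$ if $d_X(w,x)\ne d_X(w,y)$. A set $S\subseteq V(X)$ is a local metric generator for $X$ if every two adjacent vertices of $X$ are distinguished by some vertex of $S$; a local metric generator of minimum cardinality is a local metric basis, and its cardinality is the local metric dimension $\dim_l(X)$. For a graph $G$ of order $n$ with vertices $v_1,\dots,v_n$ and a graph $H$, the corona product $G\odot H$ is obtained from one copy of $G$ and $n$ disjoint copies $H_1,\dots,H_n$ of $H$ by joining $v_i$ by an edge to every vertex of $H_i$. $K_t$, $K_{r,s}$, $P_t$, $C_t$ denote the complete graph, complete bipartite graph, path and cycle of the indicated orders. -}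

module Defs where

open import Data.Nat using (ℕ; zero; suc; _+_; _*_; _≤_; _≡ᵇ_; _∸_)
open import Data.Fin using (Fin; toℕ; splitAt; remQuot)
open import Data.Fin.Subset using (Subset; _∈_; ∣_∣)
open import Data.Bool using (Bool; true; false; _∧_; _∨_; not)
open import Data.Sum using (_⊎_; inj₁; inj₂)
open import Data.Product using (Σ; ∃; _×_; _,_)
open import Relation.Binary.PropositionalEquality using (_≡_; _≢_)
open import Relation.Nullary.Decidable using (⌊_⌋)
import Data.Fin as F

Adj : ℕ → Set
Adj n = Fin n → Fin n → Bool

IsSimple : ∀ {n} → Adj n → Set
IsSimple {n} A = (∀ (i j : Fin n) → A i j ≡ A j i) × (∀ (i : Fin n) → A i i ≡ false)

data Walk {n : ℕ} (A : Adj n) : Fin n → Fin n → ℕ → Set where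
  here : ∀ {x} → Walk A x x 0
  step : ∀ {x y z k} → A x y ≡ true → Walk A y z k → Walk A x z (suc k)

Connected : ∀ {n} → Adj n → Set
Connected {n} A = ∀ (x y : Fin n) → ∃ λ k → Walk A x y k

IsDist : ∀ {n} → Adj n → Fin n → Fin n → ℕ → Set
IsDist A x y k = Walk A x y k × (∀ {m} → Walk A x y m → k ≤ m)

Distinguishes : ∀ {n} → Adj n → Fin n → Fin n → Fin n → Set
Distinguishes A w x y =
  Σ ℕ λ k → Σ ℕ λ k' → IsDist A w x k × IsDist A w y k' × k ≢ k'

IsLocalMetricGenerator : ∀ {n} → Adj n → Subset n → Set
IsLocalMetricGenerator {n} A S =
  ∀ (x y : Fin n) → A x y ≡ true → Σ (Fin n) λ w → w ∈ S × Distinguishes A w x y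

LocalMetricDim : ∀ {n} → Adj n → ℕ → Set
LocalMetricDim {n} A d =
  (Σ (Subset n) λ S → IsLocalMetricGenerator A S × ∣ S ∣ ≡ d)
  × (∀ (S : Subset n) → IsLocalMetricGenerator A S → d ≤ ∣ S ∣)

-- Corona product G ⊙ H.  Vertices: Fin (n + n * m); splitAt n sends a vertex to
-- inj₁ i (vertex v_i of G) or inj₂ p, where remQuot m p = (i , h) means vertex h of copy H_i.
corona : ∀ {n m} → Adj n → Adj m → Adj (n + n * m)
corona {n} {m} G H a b with splitAt n a | splitAt n b
... | inj₁ i | inj₁ j = G i j
... | inj₁ i | inj₂ q with remQuot {n} m q
...   | (k , _) = ⌊ i F.≟ k ⌋
corona {n} {m} G H a b | inj₂ p | inj₁ j with remQuot {n} m p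
...   | (k , _) = ⌊ k F.≟ j ⌋
corona {n} {m} G H a b | inj₂ p | inj₂ q with remQuot {n} m p | remQuot {n} m q
...   | (k , h) | (k' , h') = ⌊ k F.≟ k' ⌋ ∧ H h h'

complete : ∀ t → Adj t
complete t i j = not ⌊ i F.≟ j ⌋

completeBip : ∀ r s → Adj (r + s)
completeBip r s i j with splitAt r i | splitAt r j
... | inj₁ _ | inj₂ _ = true
... | inj₂ _ | inj₁ _ = true
... | _ | _ = false

path : ∀ t → Adj t
path t i j = (suc (toℕ i) ≡ᵇ toℕ j) ∨ (suc (toℕ j) ≡ᵇ toℕ i)

-- cycle C_t : path plus the edge {0, t-1}  (used for t ≥ 3)
cycle : ∀ t → Adj t
cycle t i j = path t i j
  ∨ ((toℕ i ≡ᵇ 0) ∧ (toℕ j ≡ᵇ (t ∸ 1)))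
  ∨ ((toℕ j ≡ᵇ 0) ∧ (toℕ i ≡ᵇ (t ∸ 1)))

-- In G ⊙ H every walk from outside a copy H_i of H into H_i passes through its hub v_i, so a vertex
-- outside H_i sees all of H_i at the same distance, while within H_i + v_i distances are min(d_H, 2).
-- Hence a local metric generator of G ⊙ H meets every copy in a local adjacency generator of H, and
-- conversely one such generator placed in every copy resolves all edges (edges of G and hub–leaf
-- edges are resolved from a suitable copy, using n ≥ 2): dim_l(G ⊙ H) = n · dim_{A,l}(H).  It remains
-- to compute dim_{A,l}: all but one vertex of K_t, one vertex of K_{r,s}, and for P_t and C_t a vertex
-- resolves at most the four edges around it, a bound attained by landmarks every four vertices
-- (2, 6, 10, …, corrected at the end according to t mod 4).

module Submission where

open import Defs
open import Data.Nat as ℕ using (ℕ; zero; suc; _+_; _*_; _∸_; _≤_; _<_; z≤n; s≤s; s≤s⁻¹; _≡ᵇ_)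
open import Data.Nat.Properties
open import Data.Nat.Induction using (<-rec)
open import Data.Nat.DivMod using (_/_; _%_; m≥n⇒m/n>0; +-distrib-/-∣ˡ; m*n/n≡m; [m+kn]%n≡m%n)
open import Data.Nat.Divisibility using (divides-refl)
open import Data.Fin as F using (Fin; toℕ; splitAt; remQuot; combine; join; _↑ˡ_; _↑ʳ_)
open import Data.Fin.Properties
  using (any?; all?; splitAt-↑ˡ; splitAt-↑ʳ; join-splitAt; remQuot-combine; combine-remQuot; ↑ʳ-injective;
         toℕ-injective; toℕ-inject₁; toℕ-fromℕ<; toℕ<n; toℕ-fromℕ)
  renaming (suc-injective to Fin-suc-injective)
open import Data.Fin.Subset using (Subset; _∈_; ∣_∣)
open import Data.Vec using (tabulate; lookup)
open import Data.Vec.Properties using (tabulate∘lookup; lookup∘tabulate; lookup⇒[]=; []=⇒lookup)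
open import Data.Bool using (Bool; true; false; _∧_; _∨_; not; if_then_else_)
open import Data.Bool.Properties using (T-≡; ∨-identityʳ) renaming (_≟_ to _≟ᵇ_)
open import Data.Product using (Σ; ∃; _×_; _,_; proj₁; proj₂; map)
open import Data.Sum using (_⊎_; inj₁; inj₂)
open import Function using (_∘_; Equivalence; mk⇔)
open import Relation.Binary.PropositionalEquality
open import Relation.Nullary using (¬_; ¬?; Dec; yes; no; contradiction)
open import Relation.Nullary.Decidable
  using (⌊_⌋; from-yes; isYes≗does; dec-true; dec-false; does-⇔; toWitness; map′; _×-dec_)
open import Relation.Unary using (Decidable)
import Algebra.Properties.CommutativeMonoid.Sum as CommutativeMonoidSum
open CommutativeMonoidSum +-0-commutativeMonoid using (sum-syntax; ∑-comm; ∑-distrib-+; sum-cong-≗)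

⌊⌋-true : ∀ {A : Set} (a? : Dec A) → A → ⌊ a? ⌋ ≡ true
⌊⌋-true a? a = trans (isYes≗does a?) (dec-true a? a)

⌊⌋-false : ∀ {A : Set} (a? : Dec A) → ¬ A → ⌊ a? ⌋ ≡ false
⌊⌋-false a? ¬a = trans (isYes≗does a?) (dec-false a? ¬a)

⌊⌋-witness : ∀ {A : Set} {a? : Dec A} → ⌊ a? ⌋ ≡ true → A
⌊⌋-witness e = toWitness (Equivalence.from T-≡ e)

∧-true₁ : ∀ {a b} → a ∧ b ≡ true → a ≡ true
∧-true₁ {true} _ = refl

∧-true₂ : ∀ {a b} → a ∧ b ≡ true → b ≡ true
∧-true₂ {true} b = b

∨-true : ∀ {a b} → a ∨ b ≡ true → a ≡ true ⊎ b ≡ true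
∨-true {true} _ = inj₁ refl
∨-true {false} b = inj₂ b

≡ᵇ-true : ∀ {m n} → m ≡ n → (m ≡ᵇ n) ≡ true
≡ᵇ-true {m} {n} = dec-true (m ℕ.≟ n)

≡ᵇ-false : ∀ {m n} → m ≢ n → (m ≡ᵇ n) ≡ false
≡ᵇ-false {m} {n} = dec-false (m ℕ.≟ n)

≡ᵇ-witness : ∀ {m n} → (m ≡ᵇ n) ≡ true → m ≡ n
≡ᵇ-witness {m} {n} e = ≡ᵇ⇒≡ m n (Equivalence.from T-≡ e)

∧-≡ᵇ-false : ∀ {x m y n} → ¬ (x ≡ m × y ≡ n) → (x ≡ᵇ m) ∧ (y ≡ᵇ n) ≡ false
∧-≡ᵇ-false {x} {m} {y} {n} ¬both with x ≡ᵇ m in p | y ≡ᵇ n in q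
... | true | true = contradiction (≡ᵇ-witness p , ≡ᵇ-witness q) ¬both
... | true | false = refl
... | false | _ = refl

⌊≟⌋≡≡ᵇ : ∀ {t} (w h : Fin t) → ⌊ w F.≟ h ⌋ ≡ (toℕ w ≡ᵇ toℕ h)
⌊≟⌋≡≡ᵇ w h =
  trans (isYes≗does (w F.≟ h)) (does-⇔ (mk⇔ (cong toℕ) toℕ-injective) (w F.≟ h) (toℕ w ℕ.≟ toℕ h))

another : ∀ {n} → 2 ≤ n → (i : Fin n) → ∃ λ j → j ≢ i
another {suc (suc n)} _ F.zero = F.suc F.zero , λ ()
another {suc (suc n)} _ (F.suc i) = F.zero , λ ()
another {suc zero} (s≤s ()) F.zero

least-witness : {P : ℕ → Set} → Decidable P → ∀ {k} → P k → ∃ λ d → P d × (∀ {j} → P j → d ≤ j)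
least-witness {P} P? {k} = <-rec (λ k → P k → Least) search k
  where
  Least : Set
  Least = ∃ λ d → P d × (∀ {j} → P j → d ≤ j)
  search : ∀ k → (∀ {j} → j < k → P j → Least) → P k → Least
  search k smaller pk with anyUpTo? P? k
  ... | yes (j , j<k , pj) = smaller j<k pj
  ... | no none = k , pk , λ pj → ≮⇒≥ λ j<k → none (_ , j<k , pj)

-- Walks and distances

module Walks {N : ℕ} (A : Adj N) where

  walk? : ∀ x y k → Dec (Walk A x y k)
  walk? x y zero with x F.≟ y
  ... | yes refl = yes here
  ... | no x≢y = no λ { here → x≢y refl }
  walk? x y (suc k) =
    map′ (λ (z , e , w) → step e w) (λ { (step e w) → _ , e , w })
         (any? λ z → (A x z ≟ᵇ true) ×-dec walk? z y k)

  shortest : ∀ {x y k} → Walk A x y k → ∃ (IsDist A x y)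
  shortest {x} {y} = least-witness (walk? x y)

  dist-unique : ∀ {x y d d'} → IsDist A x y d → IsDist A x y d' → d ≡ d'
  dist-unique (w , minimal) (w' , minimal') = ≤-antisym (minimal w') (minimal' w)

  _++ʷ_ : ∀ {x y z a b} → Walk A x y a → Walk A y z b → Walk A x z (a + b)
  here ++ʷ q = q
  step e p ++ʷ q = step e (p ++ʷ q)

  1≤length : ∀ {x y k} → x ≢ y → Walk A x y k → 1 ≤ k
  1≤length x≢y here = contradiction refl x≢y
  1≤length x≢y (step _ _) = s≤s z≤n

  2≤length : ∀ {x y k} → x ≢ y → A x y ≡ false → Walk A x y k → 2 ≤ k
  2≤length x≢y _ here = contradiction refl x≢y
  2≤length x≢y nonadjacent (step e here) = contradiction (trans (sym e) nonadjacent) λ ()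
  2≤length x≢y _ (step _ (step _ _)) = s≤s (s≤s z≤n)

  distinguishes : ∀ {w x y a b} → Walk A w x a → Walk A w y b →
    (∀ {k k'} → IsDist A w x k → IsDist A w y k' → k ≢ k') → Distinguishes A w x y
  distinguishes p q differ with shortest p | shortest q
  ... | k , dk | k' , dk' = k , k' , dk , dk' , differ dk dk'

  distinguishes-sym : ∀ {w x y} → Distinguishes A w x y → Distinguishes A w y x
  distinguishes-sym (k , k' , dk , dk' , k≢k') = k' , k , dk' , dk , k≢k' ∘ sym

-- Counting

indicator : Bool → ℕ
indicator true = 1
indicator false = 0

count : ∀ {k} → (Fin k → Bool) → ℕ
count {k} p = ∑[ i < k ] indicator (p i)

∑-mono-≤ : ∀ {k} {f g : Fin k → ℕ} → (∀ i → f i ≤ g i) → ∑[ i < k ] f i ≤ ∑[ i < k ] g i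
∑-mono-≤ {zero} _ = z≤n
∑-mono-≤ {suc k} f≤g = +-mono-≤ (f≤g F.zero) (∑-mono-≤ (f≤g ∘ F.suc))

∑-const : ∀ k c → ∑[ i < k ] c ≡ k * c
∑-const zero c = refl
∑-const (suc k) c = cong (c +_) (∑-const k c)

∑-*ʳ : ∀ {k} (f : Fin k → ℕ) c → ∑[ i < k ] (f i * c) ≡ (∑[ i < k ] f i) * c
∑-*ʳ {zero} f c = refl
∑-*ʳ {suc k} f c =
  trans (cong (f F.zero * c +_) (∑-*ʳ (f ∘ F.suc) c)) (sym (*-distribʳ-+ c (f F.zero) _))

∑-↑ : ∀ a b (f : Fin (a + b) → ℕ) →
  ∑[ x < a + b ] f x ≡ ∑[ i < a ] f (i ↑ˡ b) + ∑[ j < b ] f (a ↑ʳ j)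
∑-↑ zero b f = refl
∑-↑ (suc a) b f = trans (cong (f F.zero +_) (∑-↑ a b (f ∘ F.suc))) (sym (+-assoc (f F.zero) _ _))

∑-combine : ∀ a b (f : Fin (a * b) → ℕ) →
  ∑[ x < a * b ] f x ≡ ∑[ i < a ] ∑[ j < b ] f (combine i j)
∑-combine zero b f = refl
∑-combine (suc a) b f =
  trans (∑-↑ b (a * b) f) (cong (∑[ j < b ] f (j ↑ˡ a * b) +_) (∑-combine a b (f ∘ (b ↑ʳ_))))

count-≗ : ∀ {k} {p q : Fin k → Bool} → (∀ x → p x ≡ q x) → count p ≡ count q
count-≗ p≗q = sum-cong-≗ (cong indicator ∘ p≗q)

∣tabulate∣≡count : ∀ {k} (p : Fin k → Bool) → ∣ tabulate p ∣ ≡ count p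
∣tabulate∣≡count {zero} p = refl
∣tabulate∣≡count {suc k} p with p F.zero
... | true = cong suc (∣tabulate∣≡count (p ∘ F.suc))
... | false = ∣tabulate∣≡count (p ∘ F.suc)

∣S∣≡count : ∀ {k} (S : Subset k) → ∣ S ∣ ≡ count (lookup S)
∣S∣≡count S = trans (cong ∣_∣ (sym (tabulate∘lookup S))) (∣tabulate∣≡count (lookup S))

∈-tabulate : ∀ {k} {p : Fin k → Bool} {x} → p x ≡ true → x ∈ tabulate p
∈-tabulate {p = p} {x} px = lookup⇒[]= x (tabulate p) (trans (lookup∘tabulate p x) px)

count-all : ∀ {k} {p : Fin k → Bool} → (∀ x → p x ≡ true) → count p ≡ k
count-all {k} all = trans (count-≗ all) (trans (∑-const k 1) (*-identityʳ k))

count-none : ∀ {k} {p : Fin k → Bool} → (∀ x → p x ≡ false) → count p ≡ 0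
count-none {k} none = trans (count-≗ none) (trans (∑-const k 0) (*-zeroʳ k))

count-positive : ∀ {k} {p : Fin k → Bool} x → p x ≡ true → 1 ≤ count p
count-positive {p = p} F.zero px rewrite px = s≤s z≤n
count-positive {p = p} (F.suc x) px = ≤-trans (count-positive x px) (m≤n+m _ (indicator (p F.zero)))

positive-count-witness : ∀ {k} {p : Fin k → Bool} → 1 ≤ count p → ∃ λ x → p x ≡ true
positive-count-witness {suc k} {p} pos with p F.zero in p0
... | true = F.zero , p0
... | false = let x , px = positive-count-witness pos in F.suc x , px

count-⊆-∪ : ∀ {k} {p q r : Fin k → Bool} → (∀ x → p x ≡ true → q x ≡ true ⊎ r x ≡ true) →
  count p ≤ count q + count r
count-⊆-∪ {p = p} {q} {r} p⊆q∪r =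
  ≤-trans (∑-mono-≤ pointwise) (≤-reflexive (∑-distrib-+ (indicator ∘ q) (indicator ∘ r)))
  where
  pointwise : ∀ x → indicator (p x) ≤ indicator (q x) + indicator (r x)
  pointwise x with p x | p⊆q∪r x
  ... | false | _ = z≤n
  ... | true | into with into refl
  ...   | inj₁ qx rewrite qx = s≤s z≤n
  ...   | inj₂ rx rewrite rx = m≤n+m 1 (indicator (q x))

indicator≤1 : ∀ b → indicator b ≤ 1
indicator≤1 true = ≤-refl
indicator≤1 false = z≤n

count-interval : ∀ {k} (p : Fin k → Bool) lo hi →
  (∀ x → p x ≡ true → lo ≤ toℕ x × toℕ x < hi) → count p ≤ hi ∸ lo
count-interval {zero} p lo hi inside = z≤n
count-interval {suc k} p lo hi inside with p F.zero in p0
... | true with inside F.zero p0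
...   | lo≤0 , s≤s {n = hi'} _ rewrite n≤0⇒n≡0 lo≤0 =
        s≤s (count-interval (p ∘ F.suc) 0 hi' λ x px → z≤n , s≤s⁻¹ (proj₂ (inside (F.suc x) px)))
count-interval {suc k} p lo hi inside | false =
  ≤-trans (count-interval (p ∘ F.suc) (lo ∸ 1) (hi ∸ 1) shifted) (shrink lo)
  where
  shifted : ∀ x → p (F.suc x) ≡ true → lo ∸ 1 ≤ toℕ x × toℕ x < hi ∸ 1
  shifted x px = let lo≤ , <hi = inside (F.suc x) px in ∸-monoˡ-≤ 1 lo≤ , ∸-monoˡ-≤ 1 <hi
  shrink : ∀ lo → (hi ∸ 1) ∸ (lo ∸ 1) ≤ hi ∸ lo
  shrink zero = m∸n≤m hi 1
  shrink (suc lo) = ≤-reflexive (∸-+-assoc hi 1 lo)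

count-two-intervals : ∀ {k} (p : Fin k → Bool) h lo hi →
  (∀ x → p x ≡ true → toℕ x < h ⊎ (lo ≤ toℕ x × toℕ x < hi)) → count p ≤ h + (hi ∸ lo)
count-two-intervals {k} p h lo hi inside =
  ≤-trans (count-⊆-∪ split) (+-mono-≤ (count-interval below 0 h first) (count-interval above lo hi second))
  where
  below above : Fin k → Bool
  below x = p x ∧ (toℕ x ℕ.<ᵇ h)
  above x = p x ∧ not (toℕ x ℕ.<ᵇ h)
  split : ∀ x → p x ≡ true → below x ≡ true ⊎ above x ≡ true
  split x px rewrite px with toℕ x ℕ.<ᵇ h
  ... | true = inj₁ refl
  ... | false = inj₂ refl
  first : ∀ x → below x ≡ true → 0 ≤ toℕ x × toℕ x < h
  first x bx = z≤n , <ᵇ⇒< (toℕ x) h (Equivalence.from T-≡ (∧-true₂ {p x} bx))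
  second : ∀ x → above x ≡ true → lo ≤ toℕ x × toℕ x < hi
  second x ax with inside x (∧-true₁ ax)
  ... | inj₂ within = within
  ... | inj₁ x<h =
    contradiction (trans (sym (cong not (Equivalence.to T-≡ (<⇒<ᵇ x<h)))) (∧-true₂ {p x} ax)) λ ()

double-counting : ∀ {t E} c (T : Fin t → Bool) (R : Fin t → Fin E → Bool) →
  (∀ e → ∃ λ w → T w ≡ true × R w e ≡ true) → (∀ w → T w ≡ true → count (R w) ≤ c) →
  E ≤ count T * c
double-counting {t} {E} c T R covered bounded = begin
  E                                                    ≡⟨ sym (trans (∑-const E 1) (*-identityʳ E)) ⟩
  ∑[ e < E ] 1                                         ≤⟨ ∑-mono-≤ covered-once ⟩
  ∑[ e < E ] ∑[ w < t ] indicator (T w ∧ R w e)        ≡⟨ ∑-comm (λ e w → indicator (T w ∧ R w e)) ⟩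
  ∑[ w < t ] ∑[ e < E ] indicator (T w ∧ R w e)        ≤⟨ ∑-mono-≤ resolved-by ⟩
  ∑[ w < t ] (indicator (T w) * c)                      ≡⟨ ∑-*ʳ (indicator ∘ T) c ⟩
  count T * c                                          ∎
  where
  open ≤-Reasoning
  covered-once : ∀ e → 1 ≤ ∑[ w < t ] indicator (T w ∧ R w e)
  covered-once e with covered e
  ... | w , Tw , Rwe = count-positive w (cong₂ _∧_ Tw Rwe)
  resolved-by : ∀ w → ∑[ e < E ] indicator (T w ∧ R w e) ≤ indicator (T w) * c
  resolved-by w with T w in Tw
  ... | true = ≤-trans (bounded w Tw) (≤-reflexive (sym (+-identityʳ c)))
  ... | false = ≤-reflexive (trans (∑-const E 0) (*-zeroʳ E))

count-pair-cover : ∀ {k} (p : Fin k → Bool) → (∀ a b → a ≢ b → p a ≡ true ⊎ p b ≡ true) →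
  k ∸ 1 ≤ count p
count-pair-cover {zero} p cover = z≤n
count-pair-cover {suc k} p cover with p F.zero in p0
... | true = ≤-trans (m≤n+m∸n k 1) (s≤s (count-pair-cover (p ∘ F.suc) tail-cover))
  where
  tail-cover : ∀ a b → a ≢ b → p (F.suc a) ≡ true ⊎ p (F.suc b) ≡ true
  tail-cover a b a≢b = cover (F.suc a) (F.suc b) (a≢b ∘ Fin-suc-injective)
... | false = ≤-reflexive (sym (count-all tail-true))
  where
  tail-true : ∀ x → p (F.suc x) ≡ true
  tail-true x with cover F.zero (F.suc x) (λ ())
  ... | inj₁ p0≡true = contradiction (trans (sym p0) p0≡true) λ ()
  ... | inj₂ px = px

-- Local adjacency generators

-- The distance between a and b in the join K₁ + H, i.e. inside a copy of H together with its hub.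
coneDist : ∀ {m} → Adj m → Fin m → Fin m → ℕ
coneDist H a b = if ⌊ a F.≟ b ⌋ then 0 else if H a b then 1 else 2

IsLocalAdjacencyGenerator : ∀ {m} → Adj m → (Fin m → Bool) → Set
IsLocalAdjacencyGenerator H T =
  ∀ a b → H a b ≡ true → ∃ λ w → T w ≡ true × coneDist H w a ≢ coneDist H w b

LocalAdjacencyDim : ∀ {m} → Adj m → ℕ → Set
LocalAdjacencyDim H k =
  (∃ λ T → IsLocalAdjacencyGenerator H T × count T ≡ k)
  × (∀ T → IsLocalAdjacencyGenerator H T → k ≤ count T)

coneDist-cong : ∀ {m} (H H' : Adj m) {w a} → H w a ≡ H' w a → coneDist H w a ≡ coneDist H' w a
coneDist-cong H H' {w} {a} same = cong (λ x → if ⌊ w F.≟ a ⌋ then 0 else if x then 1 else 2) same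

coneDist-self : ∀ {m} (H : Adj m) w → coneDist H w w ≡ 0
coneDist-self H w rewrite ⌊⌋-true (w F.≟ w) refl = refl

coneDist-adjacent : ∀ {m} (H : Adj m) {w a} → w ≢ a → H w a ≡ true → coneDist H w a ≡ 1
coneDist-adjacent H {w} {a} w≢a adj rewrite ⌊⌋-false (w F.≟ a) w≢a | adj = refl

coneDist-nonadjacent : ∀ {m} (H : Adj m) {w a} → w ≢ a → H w a ≡ false → coneDist H w a ≡ 2
coneDist-nonadjacent H {w} {a} w≢a nonadj rewrite ⌊⌋-false (w F.≟ a) w≢a | nonadj = refl

endpoint-resolves : ∀ {m} (H : Adj m) {a b} → a ≢ b → H a b ≡ true → coneDist H a a ≢ coneDist H a b
endpoint-resolves H {a} a≢b adj eq =
  contradiction (trans eq (coneDist-adjacent H a≢b adj)) (subst (_≢ 1) (sym (coneDist-self H a)) λ ())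

generator-nonempty : ∀ {m} (H : Adj m) {a b} → H a b ≡ true →
  ∀ T → IsLocalAdjacencyGenerator H T → 1 ≤ count T
generator-nonempty H adj T T-generates = let w , Tw , _ = T-generates _ _ adj in count-positive w Tw

separates : ∀ {m} → Adj m → Fin m → Fin m → Fin m → Bool
separates H w a b = not (coneDist H w a ≡ᵇ coneDist H w b)

separates-true : ∀ {m} (H : Adj m) {w a b} → coneDist H w a ≢ coneDist H w b → separates H w a b ≡ true
separates-true H differ rewrite ≡ᵇ-false differ = refl

separates⇒≢ : ∀ {m} (H : Adj m) {w a b} → separates H w a b ≡ true → coneDist H w a ≢ coneDist H w b
separates⇒≢ H sep eq rewrite ≡ᵇ-true eq = contradiction sep λ ()

generator-lower-bound-by-edges : ∀ {m E} (H : Adj m) (src dst : Fin E → Fin m) c →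
  (∀ e → H (src e) (dst e) ≡ true) → (∀ w → count (λ e → separates H w (src e) (dst e)) ≤ c) →
  ∀ T → IsLocalAdjacencyGenerator H T → E ≤ count T * c
generator-lower-bound-by-edges H src dst c edge bounded T T-generates =
  double-counting c T (λ w e → separates H w (src e) (dst e)) covered (λ w _ → bounded w)
  where
  covered : ∀ e → ∃ λ w → T w ≡ true × separates H w (src e) (dst e) ≡ true
  covered e = let w , Tw , differ = T-generates (src e) (dst e) (edge e) in
    w , Tw , separates-true H {w} {src e} {dst e} differ

-- The corona product

module Corona {n m : ℕ} (G : Adj n) (H : Adj m) where

  G⊙H : Adj (n + n * m)
  G⊙H = corona G H

  open Walks G⊙H

  hub : Fin n → Fin (n + n * m)
  hub i = i ↑ˡ (n * m)

  leaf : Fin n → Fin m → Fin (n + n * m)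
  leaf i h = n ↑ʳ combine i h

  hub-hub : ∀ i j → G⊙H (hub i) (hub j) ≡ G i j
  hub-hub i j rewrite splitAt-↑ˡ n i (n * m) | splitAt-↑ˡ n j (n * m) = refl

  hub-leaf : ∀ i j h → G⊙H (hub i) (leaf j h) ≡ ⌊ i F.≟ j ⌋
  hub-leaf i j h rewrite splitAt-↑ˡ n i (n * m) | splitAt-↑ʳ n (n * m) (combine j h) =
    cong (λ p → ⌊ i F.≟ proj₁ p ⌋) (remQuot-combine j h)

  leaf-hub : ∀ i h j → G⊙H (leaf i h) (hub j) ≡ ⌊ i F.≟ j ⌋
  leaf-hub i h j rewrite splitAt-↑ʳ n (n * m) (combine i h) | splitAt-↑ˡ n j (n * m) =
    cong (λ p → ⌊ proj₁ p F.≟ j ⌋) (remQuot-combine i h)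

  leaf-leaf : ∀ i h j h' → G⊙H (leaf i h) (leaf j h') ≡ ⌊ i F.≟ j ⌋ ∧ H h h'
  leaf-leaf i h j h' rewrite splitAt-↑ʳ n (n * m) (combine i h) | splitAt-↑ʳ n (n * m) (combine j h') =
    cong₂ (λ p q → ⌊ proj₁ p F.≟ proj₁ q ⌋ ∧ H (proj₂ p) (proj₂ q))
          (remQuot-combine i h) (remQuot-combine j h')

  hub-own-leaf : ∀ i h → G⊙H (hub i) (leaf i h) ≡ true
  hub-own-leaf i h = trans (hub-leaf i i h) (⌊⌋-true (i F.≟ i) refl)

  leaf-own-hub : ∀ i h → G⊙H (leaf i h) (hub i) ≡ true
  leaf-own-hub i h = trans (leaf-hub i h i) (⌊⌋-true (i F.≟ i) refl)

  leaf-leaf-same : ∀ i a b → G⊙H (leaf i a) (leaf i b) ≡ H a b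
  leaf-leaf-same i a b = trans (leaf-leaf i a i b) (cong (_∧ H a b) (⌊⌋-true (i F.≟ i) refl))

  data View : Fin (n + n * m) → Set where
    hubᵛ : ∀ i → View (hub i)
    leafᵛ : ∀ i h → View (leaf i h)

  view : ∀ a → View a
  view a with splitAt n a in eq
  ... | inj₁ i = subst View (trans (cong (join n (n * m)) (sym eq)) (join-splitAt n (n * m) a)) (hubᵛ i)
  ... | inj₂ q = subst View (trans (cong (n ↑ʳ_) (combine-remQuot {n} m q))
                                   (trans (cong (join n (n * m)) (sym eq)) (join-splitAt n (n * m) a)))
                            (leafᵛ (proj₁ (remQuot {n} m q)) (proj₂ (remQuot {n} m q)))

  leaf-injective : ∀ {i j h h'} → leaf i h ≡ leaf j h' → i ≡ j × h ≡ h'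
  leaf-injective {i} {j} {h} {h'} e
    with trans (sym (remQuot-combine i h)) (trans (cong (remQuot m) (↑ʳ-injective n _ _ e)) (remQuot-combine j h'))
  ... | refl = refl , refl

  hub≢leaf : ∀ {i j h} → hub i ≢ leaf j h
  hub≢leaf {i} {j} {h} e
    with trans (sym (splitAt-↑ˡ n i (n * m))) (trans (cong (splitAt n) e) (splitAt-↑ʳ n (n * m) (combine j h)))
  ... | ()

  InCopy : Fin n → Fin (n + n * m) → Set
  InCopy i a = ∃ λ h → a ≡ leaf i h

  hub∉copy : ∀ {i j} → ¬ InCopy i (hub j)
  hub∉copy (_ , e) = hub≢leaf e

  leaf∉other-copy : ∀ {i j h} → j ≢ i → ¬ InCopy i (leaf j h)
  leaf∉other-copy j≢i (_ , e) = j≢i (proj₁ (leaf-injective e))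

  inCopy? : ∀ i a → Dec (InCopy i a)
  inCopy? i a with view a
  ... | hubᵛ j = no hub∉copy
  ... | leafᵛ j h with j F.≟ i
  ...   | yes refl = yes (h , refl)
  ...   | no j≢i = no (leaf∉other-copy j≢i)

  outside-neighbour-of-copy : ∀ {i w h} → ¬ InCopy i w → G⊙H w (leaf i h) ≡ true → w ≡ hub i
  outside-neighbour-of-copy {i} {w} {h} w∉ adj with view w
  ... | hubᵛ j = cong hub (⌊⌋-witness (trans (sym (hub-leaf j i h)) adj))
  ... | leafᵛ j h' with ⌊⌋-witness {a? = j F.≟ i} (∧-true₁ (trans (sym (leaf-leaf j h' i h)) adj))
  ...   | refl = contradiction (h' , refl) w∉

  lift-walk : ∀ {i j k} → Walk G i j k → Walk G⊙H (hub i) (hub j) k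
  lift-walk here = here
  lift-walk (step {x = i} e p) = step (trans (hub-hub i _) e) (lift-walk p)

  enter-copy-via-hub : ∀ {i w y k} → ¬ InCopy i w → InCopy i y → Walk G⊙H w y k →
    ∃ λ k' → k' < k × Walk G⊙H w (hub i) k'
  enter-copy-via-hub w∉ (h , refl) here = contradiction (h , refl) w∉
  enter-copy-via-hub {i} {w} w∉ y∈ (step {y = z} e p) with inCopy? i z
  ... | yes (_ , refl) = 0 , s≤s z≤n , subst (λ v → Walk G⊙H w v 0) (outside-neighbour-of-copy w∉ e) here
  ... | no z∉ = let k' , k'<k , q = enter-copy-via-hub z∉ y∈ p in suc k' , s≤s k'<k , step e q

  walk-to-copy : ∀ {i w a k} → ¬ InCopy i w → Walk G⊙H w (leaf i a) k →
    ∀ b → ∃ λ k' → k' ≤ k × Walk G⊙H w (leaf i b) k'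
  walk-to-copy {i} {k = k} w∉ p b with enter-copy-via-hub w∉ (_ , refl) p
  ... | k' , k'<k , q = k' + 1 , subst (_≤ k) (+-comm 1 k') k'<k , q ++ʷ step (hub-own-leaf i b) here

  leaves-equidistant : ∀ {i w a b k k'} → ¬ InCopy i w →
    IsDist G⊙H w (leaf i a) k → IsDist G⊙H w (leaf i b) k' → k ≡ k'
  leaves-equidistant {a = a} {b} w∉ (pa , minimal-a) (pb , minimal-b)
    with walk-to-copy w∉ pb a | walk-to-copy w∉ pa b
  ... | _ , l₁ , q₁ | _ , l₂ , q₂ = ≤-antisym (≤-trans (minimal-a q₁) l₁) (≤-trans (minimal-b q₂) l₂)

  hub-closer : ∀ {i w h k k'} → ¬ InCopy i w →
    IsDist G⊙H w (hub i) k → IsDist G⊙H w (leaf i h) k' → k < k'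
  hub-closer w∉ (_ , minimal) (q , _) with enter-copy-via-hub w∉ (_ , refl) q
  ... | _ , k''<k' , q' = ≤-<-trans (minimal q') k''<k'

  copy-dist : ∀ i a b → IsDist G⊙H (leaf i a) (leaf i b) (coneDist H a b)
  copy-dist i a b with a F.≟ b
  ... | yes refl = here , λ _ → z≤n
  ... | no a≢b with H a b in adjacent
  ...   | true = step (trans (leaf-leaf-same i a b) adjacent) here , 1≤length leaves-differ
    where leaves-differ = a≢b ∘ proj₂ ∘ leaf-injective
  ...   | false = step (leaf-own-hub i a) (step (hub-own-leaf i b) here) ,
                  2≤length leaves-differ (trans (leaf-leaf-same i a b) adjacent)
    where leaves-differ = a≢b ∘ proj₂ ∘ leaf-injective

module CoronaLocalMetricDim {n m : ℕ} (G : Adj n) (H : Adj m)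
  (simple : IsSimple G) (connected : Connected G) (2≤n : 2 ≤ n) where

  open Corona G H
  open Walks G⊙H

  lift : (Fin m → Bool) → Fin (n + n * m) → Bool
  lift T a with splitAt n a
  ... | inj₁ _ = false
  ... | inj₂ q = T (proj₂ (remQuot {n} m q))

  lift-hub : ∀ T i → lift T (hub i) ≡ false
  lift-hub T i rewrite splitAt-↑ˡ n i (n * m) = refl

  lift-leaf : ∀ T i h → lift T (leaf i h) ≡ T h
  lift-leaf T i h rewrite splitAt-↑ʳ n (n * m) (combine i h) = cong (T ∘ proj₂) (remQuot-combine i h)

  count-lift : ∀ T → count (lift T) ≡ n * count T
  count-lift T = begin
    count (lift T)
      ≡⟨ ∑-↑ n (n * m) (indicator ∘ lift T) ⟩
    count (lift T ∘ hub) + ∑[ x < n * m ] indicator (lift T (n ↑ʳ x))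
      ≡⟨ cong₂ _+_ (count-none (lift-hub T)) (∑-combine n m _) ⟩
    ∑[ i < n ] count (lift T ∘ leaf i)
      ≡⟨ sum-cong-≗ (λ i → count-≗ (lift-leaf T i)) ⟩
    ∑[ i < n ] count T
      ≡⟨ ∑-const n (count T) ⟩
    n * count T
      ∎
    where open ≡-Reasoning

  leaf-to-hub : ∀ j h i → Walk G⊙H (leaf j h) (hub i) (suc (proj₁ (connected j i)))
  leaf-to-hub j h i = step (leaf-own-hub j h) (lift-walk (proj₂ (connected j i)))

  module _ (T : Fin m → Bool) (T-generates : IsLocalAdjacencyGenerator H T) (w₀ : Fin m) (Tw₀ : T w₀ ≡ true) where

    resolved-by-lift : ∀ x → lift T x ≡ true → ∀ {a b} → Distinguishes G⊙H x a b →
      Σ (Fin (n + n * m)) λ w → w ∈ tabulate (lift T) × Distinguishes G⊙H w a b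
    resolved-by-lift x Tx d = x , ∈-tabulate Tx , d

    hub-hub-resolved : ∀ i j → G i j ≡ true → Distinguishes G⊙H (leaf i w₀) (hub i) (hub j)
    hub-hub-resolved i j Gij = distinguishes (step (leaf-own-hub i w₀) here) (leaf-to-hub i w₀ j) differ
      where
      i≢j : i ≢ j
      i≢j refl = contradiction (trans (sym Gij) (proj₂ simple i)) λ ()
      differ : ∀ {k k'} → IsDist G⊙H (leaf i w₀) (hub i) k → IsDist G⊙H (leaf i w₀) (hub j) k' → k ≢ k'
      differ (_ , minimal) (p , _) refl =
        contradiction (≤-trans (2≤length (hub≢leaf ∘ sym) nonadjacent p) (minimal (step (leaf-own-hub i w₀) here)))
                      λ { (s≤s ()) }
        where nonadjacent = trans (leaf-hub i w₀ j) (⌊⌋-false (i F.≟ j) i≢j)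

    hub-leaf-resolved : ∀ i h j → j ≢ i → Distinguishes G⊙H (leaf j w₀) (hub i) (leaf i h)
    hub-leaf-resolved i h j j≢i =
      distinguishes (leaf-to-hub j w₀ i) (leaf-to-hub j w₀ i ++ʷ step (hub-own-leaf i h) here)
                    λ dk dk' → <⇒≢ (hub-closer (leaf∉other-copy j≢i) dk dk')

    leaf-leaf-resolved : ∀ i a b w → coneDist H w a ≢ coneDist H w b →
      Distinguishes G⊙H (leaf i w) (leaf i a) (leaf i b)
    leaf-leaf-resolved i a b w differ = distinguishes (proj₁ (copy-dist i w a)) (proj₁ (copy-dist i w b))
      λ dk dk' eq → differ (trans (dist-unique (copy-dist i w a) dk) (trans eq (dist-unique dk' (copy-dist i w b))))

    lift-generates : IsLocalMetricGenerator G⊙H (tabulate (lift T))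
    lift-generates x y adj = resolve (view x) (view y) adj
      where
      resolve : ∀ {x y} → View x → View y → G⊙H x y ≡ true →
        Σ (Fin (n + n * m)) λ w → w ∈ tabulate (lift T) × Distinguishes G⊙H w x y
      resolve (hubᵛ i) (hubᵛ j) adj =
        resolved-by-lift _ (trans (lift-leaf T i w₀) Tw₀) (hub-hub-resolved i j (trans (sym (hub-hub i j)) adj))
      resolve (hubᵛ i) (leafᵛ j h) adj with ⌊⌋-witness {a? = i F.≟ j} (trans (sym (hub-leaf i j h)) adj)
      ... | refl = let j , j≢i = another 2≤n i in
        resolved-by-lift _ (trans (lift-leaf T j w₀) Tw₀) (hub-leaf-resolved i h j j≢i)
      resolve (leafᵛ i h) (hubᵛ j) adj with ⌊⌋-witness {a? = i F.≟ j} (trans (sym (leaf-hub i h j)) adj)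
      ... | refl = let j , j≢i = another 2≤n i in
        resolved-by-lift _ (trans (lift-leaf T j w₀) Tw₀) (distinguishes-sym (hub-leaf-resolved i h j j≢i))
      resolve (leafᵛ i a) (leafᵛ j b) adj
        with ⌊⌋-witness {a? = i F.≟ j} (∧-true₁ (trans (sym (leaf-leaf i a j b)) adj))
      ... | refl with T-generates a b (trans (sym (leaf-leaf-same i a b)) adj)
      ...   | w , Tw , differ = resolved-by-lift _ (trans (lift-leaf T i w) Tw) (leaf-leaf-resolved i a b w differ)

  restriction-generates : ∀ S → IsLocalMetricGenerator G⊙H S → ∀ i →
    IsLocalAdjacencyGenerator H (lookup S ∘ leaf i)
  restriction-generates S S-generates i a b adj
    with S-generates (leaf i a) (leaf i b) (trans (leaf-leaf-same i a b) adj)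
  ... | w , w∈S , k , k' , dk , dk' , k≢k' with inCopy? i w
  ...   | no w∉ = contradiction (leaves-equidistant w∉ dk dk') k≢k'
  ...   | yes (c , refl) = c , []=⇒lookup w∈S ,
          λ eq → k≢k' (trans (dist-unique dk (copy-dist i c a)) (trans eq (dist-unique (copy-dist i c b) dk')))

  generator-lower-bound : ∀ {k} → (∀ T → IsLocalAdjacencyGenerator H T → k ≤ count T) →
    ∀ S → IsLocalMetricGenerator G⊙H S → n * k ≤ ∣ S ∣
  generator-lower-bound {k} minimal S S-generates = begin
    n * k
      ≡⟨ sym (∑-const n k) ⟩
    ∑[ i < n ] k
      ≤⟨ ∑-mono-≤ (λ i → minimal _ (restriction-generates S S-generates i)) ⟩
    ∑[ i < n ] count (lookup S ∘ leaf i)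
      ≡⟨ sym (∑-combine n m _) ⟩
    ∑[ x < n * m ] indicator (lookup S (n ↑ʳ x))
      ≤⟨ m≤n+m _ _ ⟩
    count (lookup S ∘ hub) + ∑[ x < n * m ] indicator (lookup S (n ↑ʳ x))
      ≡⟨ sym (∑-↑ n (n * m) (indicator ∘ lookup S)) ⟩
    count (lookup S)
      ≡⟨ sym (∣S∣≡count S) ⟩
    ∣ S ∣
      ∎
    where open ≤-Reasoning

localMetricDim-corona : ∀ {n m} (G : Adj n) (H : Adj m) → IsSimple G → Connected G → 2 ≤ n →
  ∀ {k} → 1 ≤ k → LocalAdjacencyDim H k → LocalMetricDim (corona G H) (n * k)
localMetricDim-corona {n} G H simple connected 2≤n 1≤k ((T , T-generates , count-T) , minimal)
  with positive-count-witness (subst (1 ≤_) (sym count-T) 1≤k)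
... | w₀ , Tw₀ =
  (tabulate (lift T) , lift-generates T T-generates w₀ Tw₀ ,
   trans (∣tabulate∣≡count (lift T)) (trans (count-lift T) (cong (n *_) count-T))) ,
  generator-lower-bound minimal
  where open CoronaLocalMetricDim G H simple connected 2≤n

-- Complete and complete bipartite graphs

complete-adjacent : ∀ {t} {a b : Fin t} → a ≢ b → complete t a b ≡ true
complete-adjacent {a = a} {b} a≢b rewrite ⌊⌋-false (a F.≟ b) a≢b = refl

complete-loopless : ∀ {t} {a b : Fin t} → complete t a b ≡ true → a ≢ b
complete-loopless {a = a} adj refl rewrite ⌊⌋-true (a F.≟ a) refl = contradiction adj λ ()

complete-generator-meets-pairs : ∀ {t} T → IsLocalAdjacencyGenerator (complete t) T →
  ∀ a b → a ≢ b → T a ≡ true ⊎ T b ≡ true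
complete-generator-meets-pairs T T-generates a b a≢b with T-generates a b (complete-adjacent a≢b)
... | w , Tw , differ with w F.≟ a | w F.≟ b
...   | yes refl | _ = inj₁ Tw
...   | no _ | yes refl = inj₂ Tw
...   | no w≢a | no w≢b = contradiction refl differ  -- w is adjacent to a and b, so differ : 1 ≢ 1

allButFirst : ∀ {t} → Fin (suc t) → Bool
allButFirst F.zero = false
allButFirst (F.suc _) = true

allButFirst-generates : ∀ t → IsLocalAdjacencyGenerator (complete (suc t)) allButFirst
allButFirst-generates t F.zero F.zero adj = contradiction refl (complete-loopless {suc t} {F.zero} {F.zero} adj)
allButFirst-generates t F.zero b@(F.suc _) adj =
  b , refl , endpoint-resolves (complete (suc t)) {b} {F.zero} (λ ()) (complete-adjacent {a = b} {F.zero} λ ()) ∘ sym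
allButFirst-generates t a@(F.suc _) b adj =
  a , refl , endpoint-resolves (complete (suc t)) (complete-loopless adj) adj

localAdjacencyDim-complete : ∀ t → LocalAdjacencyDim (complete (suc t)) t
localAdjacencyDim-complete t =
  (allButFirst , allButFirst-generates t , count-all {p = allButFirst ∘ F.suc} (λ _ → refl)) ,
  λ T T-generates → count-pair-cover T (complete-generator-meets-pairs T T-generates)

module CompleteBipartite (r s : ℕ) where

  K : Adj (suc r + s)
  K = completeBip (suc r) s

  Left Right : Fin (suc r + s) → Set
  Left a = ∃ λ x → splitAt (suc r) a ≡ inj₁ x
  Right a = ∃ λ y → splitAt (suc r) a ≡ inj₂ y

  adjacent-sides : ∀ a b → K a b ≡ true → (Left a × Right b) ⊎ (Right a × Left b)
  -- the with-abstraction also rewrites the splitAt inside Left and Right, hence refl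
  adjacent-sides a b adj with splitAt (suc r) a | splitAt (suc r) b
  ... | inj₁ x | inj₂ y = inj₁ ((x , refl) , (y , refl))
  ... | inj₂ x | inj₁ y = inj₂ ((x , refl) , (y , refl))

  first-adjacent-right : ∀ b → Right b → K F.zero b ≡ true
  first-adjacent-right b (_ , eb) rewrite eb = refl

  first-nonadjacent-left : ∀ a → Left a → K F.zero a ≡ false
  first-nonadjacent-left a (_ , ea) rewrite ea = refl

  coneDist-first-right : ∀ b → Right b → coneDist K F.zero b ≡ 1
  coneDist-first-right b rb@(_ , eb) =
    coneDist-adjacent K {F.zero} {b} (λ { refl → contradiction eb λ () }) (first-adjacent-right b rb)

  coneDist-first-left : ∀ a → Left a → coneDist K F.zero a ≢ 1
  coneDist-first-left F.zero _ = λ ()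
  coneDist-first-left a@(F.suc _) la =
    subst (_≢ 1) (sym (coneDist-nonadjacent K {F.zero} {a} (λ ()) (first-nonadjacent-left a la))) λ ()

  isFirst : Fin (suc r + s) → Bool
  isFirst F.zero = true
  isFirst (F.suc _) = false

  isFirst-generates : IsLocalAdjacencyGenerator K isFirst
  isFirst-generates a b adj with adjacent-sides a b adj
  ... | inj₁ (la , rb) = F.zero , refl , λ eq → coneDist-first-left a la (trans eq (coneDist-first-right b rb))
  ... | inj₂ (ra , lb) = F.zero , refl , λ eq → coneDist-first-left b lb (trans (sym eq) (coneDist-first-right a ra))

localAdjacencyDim-completeBip : ∀ r s → LocalAdjacencyDim (completeBip (suc r) (suc s)) 1
localAdjacencyDim-completeBip r s =
  (isFirst , isFirst-generates , cong suc (count-none {p = isFirst ∘ F.suc} λ _ → refl)) ,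
  generator-nonempty K {F.zero} {suc r ↑ʳ F.zero}
    (first-adjacent-right _ (F.zero , splitAt-↑ʳ (suc r) (suc s) F.zero))
  where open CompleteBipartite r (suc s)

-- Paths and cycles

pathConeDist : ℕ → ℕ → ℕ
pathConeDist x y = if x ≡ᵇ y then 0 else if (suc x ≡ᵇ y) ∨ (suc y ≡ᵇ x) then 1 else 2

coneDist-path : ∀ {t} (w h : Fin t) → coneDist (path t) w h ≡ pathConeDist (toℕ w) (toℕ h)
coneDist-path w h rewrite ⌊≟⌋≡≡ᵇ w h = refl

pathConeDist-resolves⇒near : ∀ w b → pathConeDist w b ≢ pathConeDist w (suc b) → b ≤ suc w × w ≤ suc (suc b)
pathConeDist-resolves⇒near 0 0 _ = z≤n , z≤n
pathConeDist-resolves⇒near 0 1 _ = s≤s z≤n , z≤n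
pathConeDist-resolves⇒near 0 (suc (suc b)) differ = contradiction refl differ
pathConeDist-resolves⇒near 1 0 _ = z≤n , s≤s z≤n
pathConeDist-resolves⇒near 2 0 _ = z≤n , s≤s (s≤s z≤n)
pathConeDist-resolves⇒near (suc (suc (suc w))) 0 differ = contradiction refl differ
pathConeDist-resolves⇒near (suc w) (suc b) differ = map s≤s s≤s (pathConeDist-resolves⇒near w b differ)

pathConeDist-suc : ∀ x → pathConeDist x (suc x) ≡ 1
pathConeDist-suc zero = refl
pathConeDist-suc (suc x) = pathConeDist-suc x

pathConeDist-far : ∀ {x y} → 2 + x ≤ y → pathConeDist x y ≡ 2
pathConeDist-far {zero} {suc (suc y)} _ = refl
pathConeDist-far {zero} {suc zero} (s≤s ())
pathConeDist-far {suc x} {suc y} (s≤s 2+x≤y) = pathConeDist-far 2+x≤y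

pathConeDist-far' : ∀ {x y} → 2 + y ≤ x → pathConeDist x y ≡ 2
pathConeDist-far' {suc (suc x)} {zero} _ = refl
pathConeDist-far' {suc zero} {zero} (s≤s ())
pathConeDist-far' {suc x} {suc y} (s≤s 2+y≤x) = pathConeDist-far' 2+y≤x

-- Landmarks stay off both ends of the path (w ≥ 1 here, w < e in ResolvesPathEdges), so that the
-- same landmarks also serve for the cycle.
Resolves : (ℕ → Bool) → ℕ → ℕ → Set
Resolves g w b = 1 ≤ w × g w ≡ true × pathConeDist w b ≢ pathConeDist w (suc b)

resolves? : ∀ g w b → Dec (Resolves g w b)
resolves? g w b = (1 ℕ.≤? w) ×-dec (g w ≟ᵇ true) ×-dec ¬? (pathConeDist w b ℕ.≟ pathConeDist w (suc b))

-- The path on e + 1 vertices has the e edges {b, b + 1}, b : Fin e.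
ResolvesPathEdges : ℕ → (ℕ → Bool) → Set
ResolvesPathEdges e g = ∀ (b : Fin e) → ∃ λ (w : Fin e) → Resolves g (toℕ w) (toℕ b)

resolvesPathEdges? : ∀ e g → Dec (ResolvesPathEdges e g)
resolvesPathEdges? e g = all? λ b → any? λ w → resolves? g (toℕ w) (toℕ b)

prepend : (ℕ → Bool) → ℕ → Bool
prepend g 0 = false
prepend g 1 = false
prepend g 2 = true
prepend g 3 = false
prepend g (suc (suc (suc (suc x)))) = g x

prepend-resolves : ∀ {e g} → ResolvesPathEdges e g → ResolvesPathEdges (4 + e) (prepend g)
prepend-resolves resolved F.zero = F.suc (F.suc F.zero) , s≤s z≤n , refl , λ ()
prepend-resolves resolved (F.suc F.zero) = F.suc (F.suc F.zero) , s≤s z≤n , refl , λ ()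
prepend-resolves resolved (F.suc (F.suc F.zero)) = F.suc (F.suc F.zero) , s≤s z≤n , refl , λ ()
prepend-resolves resolved (F.suc (F.suc (F.suc F.zero))) = F.suc (F.suc F.zero) , s≤s z≤n , refl , λ ()
prepend-resolves resolved (F.suc (F.suc (F.suc (F.suc b)))) with resolved b
... | w , (_ , gw , differ) = F.suc (F.suc (F.suc (F.suc w))) , s≤s z≤n , gw , differ

-- periodic q g has the landmarks 2, 6, …, 4q − 2 followed by g shifted by 4q.
periodic : ℕ → (ℕ → Bool) → ℕ → Bool
periodic zero g = g
periodic (suc q) g = prepend (periodic q g)

periodic-resolves : ∀ q {e g} → ResolvesPathEdges e g → ResolvesPathEdges (q * 4 + e) (periodic q g)
periodic-resolves zero resolved = resolved
periodic-resolves (suc q) resolved = prepend-resolves (periodic-resolves q resolved)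

count-periodic : ∀ q {e} g → count {suc (q * 4 + e)} (periodic q g ∘ toℕ) ≡ q + count {suc e} (g ∘ toℕ)
count-periodic zero g = refl
count-periodic (suc q) g = cong suc (count-periodic q g)

periodic-shift : ∀ q g x → periodic q g (q * 4 + x) ≡ g x
periodic-shift zero g x = refl
periodic-shift (suc q) g x = periodic-shift q g x

≤-ceil : ∀ {k c E} → k * 4 ≤ E + 3 → E ≤ c * 4 → k ≤ c
≤-ceil {k} {c} {E} k≤⌈E/4⌉ E≤4c = m<1+n⇒m≤n (*-cancelʳ-< 4 k (suc c) (begin-strict
  k * 4       ≤⟨ k≤⌈E/4⌉ ⟩
  E + 3       ≤⟨ +-monoˡ-≤ 3 E≤4c ⟩
  c * 4 + 3   <⟨ +-monoʳ-< (c * 4) (n<1+n 3) ⟩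
  c * 4 + 4   ≡⟨ +-comm (c * 4) 4 ⟩
  suc c * 4   ∎))
  where open ≤-Reasoning

window-size : ∀ w → 2 + w ∸ (w ∸ 2) ≤ 4
window-size 0 = s≤s (s≤s z≤n)
window-size 1 = s≤s (s≤s (s≤s z≤n))
window-size (suc (suc w)) = ≤-reflexive (trans (+-∸-assoc 4 (≤-refl {w})) (cong (4 +_) (n∸n≡0 w)))

module PathGraph (e : ℕ) where

  P : Adj (suc e)
  P = path (suc e)

  path-edge : ∀ i → P (F.inject₁ i) (F.suc i) ≡ true
  path-edge i rewrite toℕ-inject₁ i | ≡ᵇ-true {toℕ i} refl = refl

  path-edge-index : ∀ {a b : Fin (suc e)} → suc (toℕ a) ≡ toℕ b →
    ∃ λ (i : Fin e) → a ≡ F.inject₁ i × b ≡ F.suc i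
  path-edge-index {a} {b} a+1≡b =
    i , toℕ-injective (sym (trans (toℕ-inject₁ i) (toℕ-fromℕ< a<e))) ,
        toℕ-injective (sym (trans (cong suc (toℕ-fromℕ< a<e)) a+1≡b))
    where
    a<e : toℕ a < e
    a<e = s≤s⁻¹ (subst (_< suc e) (sym a+1≡b) (toℕ<n b))
    i = F.fromℕ< a<e

  path-adjacent : ∀ {a b} → P a b ≡ true →
    ∃ λ i → (a ≡ F.inject₁ i × b ≡ F.suc i) ⊎ (a ≡ F.suc i × b ≡ F.inject₁ i)
  path-adjacent adj with ∨-true adj
  ... | inj₁ ascending = let i , ea , eb = path-edge-index (≡ᵇ-witness ascending) in i , inj₁ (ea , eb)
  ... | inj₂ descending = let i , eb , ea = path-edge-index (≡ᵇ-witness descending) in i , inj₂ (ea , eb)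

  coneDist-path-edge : ∀ (w i : Fin e) →
    coneDist P (F.inject₁ w) (F.inject₁ i) ≡ pathConeDist (toℕ w) (toℕ i)
    × coneDist P (F.inject₁ w) (F.suc i) ≡ pathConeDist (toℕ w) (suc (toℕ i))
  coneDist-path-edge w i =
    trans (coneDist-path (F.inject₁ w) (F.inject₁ i)) (cong₂ pathConeDist (toℕ-inject₁ w) (toℕ-inject₁ i)) ,
    trans (coneDist-path (F.inject₁ w) (F.suc i)) (cong (λ x → pathConeDist x (suc (toℕ i))) (toℕ-inject₁ w))

  path-edge-resolved : ∀ g → ResolvesPathEdges e g → ∀ i → ∃ λ (w : Fin e) →
    1 ≤ toℕ w × g (toℕ (F.inject₁ w)) ≡ true ×
    coneDist P (F.inject₁ w) (F.inject₁ i) ≢ coneDist P (F.inject₁ w) (F.suc i)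
  path-edge-resolved g resolved i with resolved i
  ... | w , 1≤w , gw , differ =
    w , 1≤w , trans (cong g (toℕ-inject₁ w)) gw ,
    λ eq → differ (trans (sym (proj₁ (coneDist-path-edge w i))) (trans eq (proj₂ (coneDist-path-edge w i))))

  path-generator : ∀ g → ResolvesPathEdges e g → IsLocalAdjacencyGenerator P (g ∘ toℕ)
  path-generator g resolved a b adj with path-adjacent {a} {b} adj
  ... | i , inj₁ (refl , refl) =
    let w , _ , gw , differ = path-edge-resolved g resolved i in F.inject₁ w , gw , differ
  ... | i , inj₂ (refl , refl) =
    let w , _ , gw , differ = path-edge-resolved g resolved i in F.inject₁ w , gw , differ ∘ sym

  separation-window : ∀ w i → separates P w (F.inject₁ i) (F.suc i) ≡ true →
    toℕ w ∸ 2 ≤ toℕ i × toℕ i < 2 + toℕ w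
  separation-window w i sep with pathConeDist-resolves⇒near (toℕ w) (toℕ i) (λ eq →
    separates⇒≢ P {w} sep (trans (coneDist-path w _) (trans (cong (pathConeDist (toℕ w)) (toℕ-inject₁ i))
                                                      (trans eq (sym (coneDist-path w (F.suc i)))))))
  ... | i≤w+1 , w≤i+2 = m≤n+o⇒m∸n≤o (toℕ w) 2 w≤i+2 , s≤s i≤w+1

  separated-path-edges : ∀ w → count (λ i → separates P w (F.inject₁ i) (F.suc i)) ≤ 4
  separated-path-edges w =
    ≤-trans (count-interval _ (toℕ w ∸ 2) (2 + toℕ w) (separation-window w)) (window-size (toℕ w))

  localAdjacencyDim-from-landmarks : ∀ g {k} → ResolvesPathEdges e g → count {suc e} (g ∘ toℕ) ≡ k →
    k * 4 ≤ e + 3 → LocalAdjacencyDim P k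
  localAdjacencyDim-from-landmarks g resolved count-g k≤⌈e/4⌉ =
    (g ∘ toℕ , path-generator g resolved , count-g) ,
    λ T T-generates → ≤-ceil k≤⌈e/4⌉
      (generator-lower-bound-by-edges P F.inject₁ F.suc 4 path-edge separated-path-edges T T-generates)

module CycleGraph (s : ℕ) where

  e : ℕ
  e = 3 + s

  open PathGraph e hiding (localAdjacencyDim-from-landmarks)

  C : Adj (suc e)
  C = cycle (suc e)

  NotWrap : Fin (suc e) → Fin (suc e) → Set
  NotWrap a b = ¬ (toℕ a ≡ 0 × toℕ b ≡ e) × ¬ (toℕ b ≡ 0 × toℕ a ≡ e)

  cycle-path : ∀ {a b} → NotWrap a b → C a b ≡ P a b
  cycle-path {a} {b} (h₁ , h₂) rewrite ∧-≡ᵇ-false h₁ | ∧-≡ᵇ-false h₂ = ∨-identityʳ (P a b)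

  separates-cycle-path : ∀ {w a b} → NotWrap w a → NotWrap w b → separates C w a b ≡ separates P w a b
  separates-cycle-path {w} {a} {b} wa wb =
    cong₂ (λ x y → not (x ≡ᵇ y)) (coneDist-cong C P {w} {a} (cycle-path {w} {a} wa))
                                 (coneDist-cong C P {w} {b} (cycle-path {w} {b} wb))

  interior-not-wrap : ∀ {w} → 1 ≤ toℕ w → toℕ w < e → ∀ a → NotWrap w a
  interior-not-wrap 1≤w w<e a =
    (λ (w≡0 , _) → contradiction (subst (1 ≤_) w≡0 1≤w) λ ()) , (λ (_ , w≡e) → <-irrefl w≡e w<e)

  interior-coneDist : ∀ {w} → 1 ≤ toℕ w → toℕ w < e → ∀ a → coneDist C w a ≡ coneDist P w a
  interior-coneDist {w} 1≤w w<e a = coneDist-cong C P {w} {a} (cycle-path {w} {a} (interior-not-wrap {w} 1≤w w<e a))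

  interior-landmark : ∀ g → ResolvesPathEdges e g → ∀ i →
    ∃ λ w → g (toℕ w) ≡ true × coneDist C w (F.inject₁ i) ≢ coneDist C w (F.suc i)
  interior-landmark g resolved i with path-edge-resolved g resolved i
  ... | w , 1≤w , gw , differ = F.inject₁ w , gw ,
    λ eq → differ (trans (sym (interior-coneDist 1≤w' w'<e (F.inject₁ i)))
                         (trans eq (interior-coneDist 1≤w' w'<e (F.suc i))))
    where
    1≤w' = subst (1 ≤_) (sym (toℕ-inject₁ w)) 1≤w
    w'<e = subst (_< e) (sym (toℕ-inject₁ w)) (toℕ<n w)

  penultimate : Fin (suc e)
  penultimate = F.inject₁ (F.fromℕ (2 + s))

  toℕ-penultimate : toℕ penultimate ≡ 2 + s
  toℕ-penultimate = trans (toℕ-inject₁ (F.fromℕ (2 + s))) (toℕ-fromℕ (2 + s))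

  coneDist-penultimate : ∀ a → coneDist C penultimate a ≡ pathConeDist (2 + s) (toℕ a)
  coneDist-penultimate a =
    trans (interior-coneDist (subst (1 ≤_) (sym toℕ-penultimate) (s≤s z≤n))
                             (subst (_< e) (sym toℕ-penultimate) ≤-refl) a)
          (trans (coneDist-path penultimate a) (cong (λ x → pathConeDist x (toℕ a)) toℕ-penultimate))

  penultimate-resolves-wrap : ∀ {a b} → toℕ a ≡ 0 → toℕ b ≡ e →
    coneDist C penultimate a ≢ coneDist C penultimate b
  penultimate-resolves-wrap {a} {b} a≡0 b≡e eq
    with trans (sym (trans (coneDist-penultimate a) (cong (pathConeDist (2 + s)) a≡0)))
               (trans eq (trans (coneDist-penultimate b)
                                (trans (cong (pathConeDist (2 + s)) b≡e) (pathConeDist-suc (2 + s)))))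
  ... | ()

  cycle-generator : ∀ g → ResolvesPathEdges e g → g (2 + s) ≡ true → IsLocalAdjacencyGenerator C (g ∘ toℕ)
  cycle-generator g resolved g-penultimate a b adj with ∨-true adj
  ... | inj₁ path-adj with path-adjacent {a} {b} path-adj
  ...   | i , inj₁ (refl , refl) = interior-landmark g resolved i
  ...   | i , inj₂ (refl , refl) = let w , gw , differ = interior-landmark g resolved i in w , gw , differ ∘ sym
  cycle-generator g resolved g-penultimate a b adj | inj₂ wrap with ∨-true wrap
  ... | inj₁ ascending = penultimate , trans (cong g toℕ-penultimate) g-penultimate ,
    penultimate-resolves-wrap {a} {b} (≡ᵇ-witness (∧-true₁ ascending))
                                      (≡ᵇ-witness (∧-true₂ {toℕ a ≡ᵇ 0} ascending))
  ... | inj₂ descending = penultimate , trans (cong g toℕ-penultimate) g-penultimate ,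
    penultimate-resolves-wrap {b} {a} (≡ᵇ-witness (∧-true₁ descending))
                                      (≡ᵇ-witness (∧-true₂ {toℕ b ≡ᵇ 0} descending)) ∘ sym

  last : Fin (suc e)
  last = F.fromℕ e

  src dst : Fin (suc e) → Fin (suc e)
  src F.zero = last
  src (F.suc i) = F.inject₁ i
  dst F.zero = F.zero
  dst (F.suc i) = F.suc i

  cycle-edge : ∀ ε → C (src ε) (dst ε) ≡ true
  -- the wrap edge {e, 0}; its adjacency normalises to toℕ (fromℕ s) ≡ᵇ s
  cycle-edge F.zero = ≡ᵇ-true (toℕ-fromℕ s)
  cycle-edge (F.suc i) rewrite path-edge i = refl

  edge-separated : Fin (suc e) → Fin e → Bool
  edge-separated w i = separates C w (F.inject₁ i) (F.suc i)

  inject₁-not-last : ∀ i → toℕ (F.inject₁ i) ≢ e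
  inject₁-not-last i i≡e = <-irrefl (trans (sym (toℕ-inject₁ i)) i≡e) (toℕ<n i)

  first-window : ∀ {w} → toℕ w ≡ 0 → ∀ i → edge-separated w i ≡ true →
    toℕ i < 2 ⊎ (2 + s ≤ toℕ i × toℕ i < e)
  first-window {w} w≡0 i sep with suc (toℕ i) ℕ.≟ e
  ... | yes i+1≡e = inj₂ (≤-reflexive (sym (suc-injective i+1≡e)) , toℕ<n i)
  ... | no i+1≢e = inj₁ (subst (λ x → toℕ i < 2 + x) w≡0
                          (proj₂ (separation-window w i (trans (sym (separates-cycle-path {w} wi wi+1)) sep))))
    where
    wi : NotWrap w (F.inject₁ i)
    wi = (λ (_ , i≡e) → inject₁-not-last i i≡e) ,
         (λ (_ , w≡e) → contradiction (trans (sym w≡0) w≡e) λ ())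
    wi+1 : NotWrap w (F.suc i)
    wi+1 = (λ (_ , i+1≡e) → i+1≢e i+1≡e) , (λ (i+1≡0 , _) → contradiction i+1≡0 λ ())

  last-window : ∀ {w} → toℕ w ≡ e → ∀ i → edge-separated w i ≡ true →
    toℕ i < 1 ⊎ (1 + s ≤ toℕ i × toℕ i < e)
  last-window {w} w≡e i sep with toℕ i ℕ.≟ 0
  ... | yes i≡0 = inj₁ (subst (_< 1) (sym i≡0) (s≤s z≤n))
  ... | no i≢0 = inj₂ (subst (λ x → x ∸ 2 ≤ toℕ i) w≡e
                        (proj₁ (separation-window w i (trans (sym (separates-cycle-path {w} wi wi+1)) sep))) , toℕ<n i)
    where
    w≢0 : toℕ w ≢ 0
    w≢0 w≡0 = contradiction (trans (sym w≡0) w≡e) λ ()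
    wi : NotWrap w (F.inject₁ i)
    wi = (λ (w≡0 , _) → w≢0 w≡0) , (λ (i≡0 , _) → i≢0 (trans (sym (toℕ-inject₁ i)) i≡0))
    wi+1 : NotWrap w (F.suc i)
    wi+1 = (λ (w≡0 , _) → w≢0 w≡0) , (λ (i+1≡0 , _) → contradiction i+1≡0 λ ())

  interior-window : ∀ {w} → 1 ≤ toℕ w → toℕ w < e → ∀ i → edge-separated w i ≡ true →
    toℕ w ∸ 2 ≤ toℕ i × toℕ i < 2 + toℕ w
  interior-window {w} 1≤w w<e i sep = separation-window w i (trans (sym (interior-separated i)) sep)
    where
    interior-separated : ∀ i → edge-separated w i ≡ separates P w (F.inject₁ i) (F.suc i)
    interior-separated i = separates-cycle-path {w} (interior-not-wrap 1≤w w<e _) (interior-not-wrap 1≤w w<e _)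

  wrap-unseparated : ∀ {w} → 2 ≤ toℕ w → 2 + toℕ w ≤ e → separates C w last F.zero ≡ false
  wrap-unseparated {w} 2≤w 2+w≤e = cong₂ (λ x y → not (x ≡ᵇ y)) at-last at-first
    where
    1≤w = ≤-trans (n≤1+n 1) 2≤w
    w<e = ≤-trans (n≤1+n _) 2+w≤e
    at-last : coneDist C w last ≡ 2
    at-last = trans (interior-coneDist 1≤w w<e last) (trans (coneDist-path w last)
                (trans (cong (pathConeDist (toℕ w)) (toℕ-fromℕ e)) (pathConeDist-far 2+w≤e)))
    at-first : coneDist C w F.zero ≡ 2
    at-first = trans (interior-coneDist 1≤w w<e F.zero) (trans (coneDist-path w F.zero) (pathConeDist-far' 2≤w))

  with-wrap : ∀ {w} → count (edge-separated w) ≤ 3 → count (λ ε → separates C w (src ε) (dst ε)) ≤ 4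
  with-wrap {w} = +-mono-≤ (indicator≤1 (separates C w last F.zero))

  separated-from-interior : ∀ {w} → 1 ≤ toℕ w → toℕ w < e →
    count (λ ε → separates C w (src ε) (dst ε)) ≤ 4
  separated-from-interior {w} 1≤w w<e with toℕ w ℕ.≟ 1 | toℕ w ℕ.≟ 2 + s
  ... | yes w≡1 | _ = with-wrap {w} (count-interval _ 0 3 λ i sep →
          z≤n , subst (λ x → toℕ i < 2 + x) w≡1 (proj₂ (interior-window 1≤w w<e i sep)))
  ... | no _ | yes w≡2+s = with-wrap {w} (≤-trans (count-interval _ s e λ i sep →
          subst (λ x → x ∸ 2 ≤ toℕ i) w≡2+s (proj₁ (interior-window 1≤w w<e i sep)) , toℕ<n i)
          (≤-reflexive (m+n∸n≡m 3 s)))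
  ... | no w≢1 | no w≢2+s
    rewrite wrap-unseparated {w} (≤∧≢⇒< 1≤w (w≢1 ∘ sym)) (s≤s (≤∧≢⇒< (s≤s⁻¹ w<e) w≢2+s)) =
    ≤-trans (count-interval _ (toℕ w ∸ 2) (2 + toℕ w) (interior-window 1≤w w<e)) (window-size (toℕ w))

  -- Only 0, 1, e − 1 and e separate the wrap edge, and from exactly these vertices the window of
  -- separated path edges is cut down to three.
  separated-cycle-edges : ∀ w → count (λ ε → separates C w (src ε) (dst ε)) ≤ 4
  separated-cycle-edges w with toℕ w ℕ.≟ 0 | toℕ w ℕ.≟ e
  ... | yes w≡0 | _ = with-wrap {w}
    (≤-trans (count-two-intervals _ 2 (2 + s) e (first-window w≡0)) (≤-reflexive (cong (2 +_) (m+n∸n≡m 1 s))))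
  ... | no _ | yes w≡e = with-wrap {w}
    (≤-trans (count-two-intervals _ 1 (1 + s) e (last-window w≡e)) (≤-reflexive (cong (1 +_) (m+n∸n≡m 2 s))))
  ... | no w≢0 | no w≢e = separated-from-interior (n≢0⇒n>0 w≢0) (≤∧≢⇒< (s≤s⁻¹ (toℕ<n w)) w≢e)

  localAdjacencyDim-from-landmarks : ∀ g {k} → ResolvesPathEdges e g → g (2 + s) ≡ true →
    count {suc e} (g ∘ toℕ) ≡ k → k * 4 ≤ suc e + 3 → LocalAdjacencyDim C k
  localAdjacencyDim-from-landmarks g resolved g-penultimate count-g k≤⌈t/4⌉ =
    (g ∘ toℕ , cycle-generator g resolved g-penultimate , count-g) ,
    λ T T-generates → ≤-ceil k≤⌈t/4⌉
      (generator-lower-bound-by-edges C src dst 4 cycle-edge separated-cycle-edges T T-generates)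

periodic-bound : ∀ q {k E} → k * 4 ≤ E → (q + k) * 4 ≤ q * 4 + E
periodic-bound q {k} {E} k*4≤E = subst (_≤ q * 4 + E) (sym (*-distribʳ-+ 4 q k)) (+-monoʳ-≤ (q * 4) k*4≤E)

localAdjacencyDim-periodic-path : ∀ q {e} g {k} → ResolvesPathEdges e g → count {suc e} (g ∘ toℕ) ≡ k →
  k * 4 ≤ e + 3 → LocalAdjacencyDim (path (suc (q * 4 + e))) (q + k)
localAdjacencyDim-periodic-path q {e} g {k} resolved count-g k*4≤ =
  PathGraph.localAdjacencyDim-from-landmarks (q * 4 + e) (periodic q g) (periodic-resolves q {e} {g} resolved)
    (trans (count-periodic q g) (cong (q +_) count-g))
    (subst ((q + k) * 4 ≤_) (sym (+-assoc (q * 4) e 3)) (periodic-bound q {k} {e + 3} k*4≤))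

localAdjacencyDim-periodic-cycle : ∀ q {e} g {k} → 3 ≤ e → ResolvesPathEdges e g → g (e ∸ 1) ≡ true →
  count {suc e} (g ∘ toℕ) ≡ k → k * 4 ≤ suc e + 3 → LocalAdjacencyDim (cycle (suc (q * 4 + e))) (q + k)
localAdjacencyDim-periodic-cycle q {e} g {k} 3≤e resolved g-penultimate count-g k*4≤ =
  cycle-of-length (q * 4 + e) (periodic q g) (≤-trans 3≤e (m≤n+m e (q * 4))) (periodic-resolves q {e} {g} resolved)
    (trans (cong (periodic q g) (+-∸-assoc (q * 4) (≤-trans (s≤s z≤n) 3≤e)))
           (trans (periodic-shift q g (e ∸ 1)) g-penultimate))
    (trans (count-periodic q g) (cong (q +_) count-g))
    (subst ((q + k) * 4 ≤_) (trans (+-suc (q * 4) (e + 3)) (cong suc (sym (+-assoc (q * 4) e 3))))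
           (periodic-bound q {k} {suc e + 3} k*4≤))
  where
  cycle-of-length : ∀ e g {k} → 3 ≤ e → ResolvesPathEdges e g → g (e ∸ 1) ≡ true →
    count {suc e} (g ∘ toℕ) ≡ k → k * 4 ≤ suc e + 3 → LocalAdjacencyDim (cycle (suc e)) k
  cycle-of-length _ g (s≤s (s≤s (s≤s {n = s} z≤n))) = CycleGraph.localAdjacencyDim-from-landmarks s g

data Residue4 (t : ℕ) : Set where
  4q+4 : ∀ q → t ≡ suc (q * 4 + 3) → Residue4 t
  4q+5 : ∀ q → t ≡ suc (q * 4 + 4) → Residue4 t
  4q+6 : ∀ q → t ≡ suc (q * 4 + 5) → Residue4 t
  4q+7 : ∀ q → t ≡ suc (q * 4 + 6) → Residue4 t

residue4 : ∀ t → 4 ≤ t → Residue4 t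
residue4 4 _ = 4q+4 0 refl
residue4 5 _ = 4q+5 0 refl
residue4 6 _ = 4q+6 0 refl
residue4 7 _ = 4q+7 0 refl
residue4 1 (s≤s ())
residue4 2 (s≤s (s≤s ()))
residue4 3 (s≤s (s≤s (s≤s ())))
residue4 (suc (suc (suc (suc (suc (suc (suc (suc t)))))))) _ with residue4 (4 + t) (s≤s (s≤s (s≤s (s≤s z≤n))))
... | 4q+4 q eq = 4q+4 (suc q) (cong (4 +_) eq)
... | 4q+5 q eq = 4q+5 (suc q) (cong (4 +_) eq)
... | 4q+6 q eq = 4q+6 (suc q) (cong (4 +_) eq)
... | 4q+7 q eq = 4q+7 (suc q) (cong (4 +_) eq)

quotient-shift : ∀ q c → (q * 4 + c) / 4 ≡ q + c / 4
quotient-shift q c = trans (+-distrib-/-∣ˡ c (divides-refl q)) (cong (_+ c / 4) (m*n/n≡m q 4))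

floor-quotient : ∀ q e → suc (q * 4 + e) / 4 ≡ q + suc e / 4
floor-quotient q e = trans (cong (_/ 4) (sym (+-suc (q * 4) e))) (quotient-shift q (suc e))

ceil-quotient : ∀ q e → (suc (q * 4 + e) + 3) / 4 ≡ q + (suc e + 3) / 4
ceil-quotient q e =
  trans (cong (_/ 4) (trans (cong (_+ 3) (sym (+-suc (q * 4) e))) (+-assoc (q * 4) (suc e) 3)))
        (quotient-shift q (suc e + 3))

remainder : ∀ q e → suc (q * 4 + e) % 4 ≡ suc e % 4
remainder q e =
  trans (cong (_% 4) (trans (sym (+-suc (q * 4) e)) (+-comm (q * 4) (suc e)))) ([m+kn]%n≡m%n (suc e) q 4)

landmarks₂ landmarks₂₃ landmarks₂₄ landmarks₁₅ : ℕ → Bool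
landmarks₂ x = x ≡ᵇ 2
landmarks₂₃ x = (x ≡ᵇ 2) ∨ (x ≡ᵇ 3)
landmarks₂₄ x = (x ≡ᵇ 2) ∨ (x ≡ᵇ 4)
landmarks₁₅ x = (x ≡ᵇ 1) ∨ (x ≡ᵇ 5)

localAdjacencyDim-path : ∀ t → 4 ≤ t →
  (t % 4 ≡ 1 → LocalAdjacencyDim (path t) (t / 4)) × (t % 4 ≢ 1 → LocalAdjacencyDim (path t) ((t + 3) / 4))
localAdjacencyDim-path t 4≤t with residue4 t 4≤t
... | 4q+4 q refl =
  (λ t%4≡1 → contradiction (trans (sym (remainder q 3)) t%4≡1) λ ()) ,
  λ _ → subst (LocalAdjacencyDim (path t)) (sym (ceil-quotient q 3))
    (localAdjacencyDim-periodic-path q landmarks₂ (from-yes (resolvesPathEdges? 3 landmarks₂))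
       refl (≤ᵇ⇒≤ _ _ _))
... | 4q+5 q refl =
  (λ _ → subst (LocalAdjacencyDim (path t)) (sym (floor-quotient q 4))
    (localAdjacencyDim-periodic-path q landmarks₂ (from-yes (resolvesPathEdges? 4 landmarks₂))
       refl (≤ᵇ⇒≤ _ _ _))) ,
  λ t%4≢1 → contradiction (remainder q 4) t%4≢1
... | 4q+6 q refl =
  (λ t%4≡1 → contradiction (trans (sym (remainder q 5)) t%4≡1) λ ()) ,
  λ _ → subst (LocalAdjacencyDim (path t)) (sym (ceil-quotient q 5))
    (localAdjacencyDim-periodic-path q landmarks₂₄ (from-yes (resolvesPathEdges? 5 landmarks₂₄))
       refl (≤ᵇ⇒≤ _ _ _))
... | 4q+7 q refl =
  (λ t%4≡1 → contradiction (trans (sym (remainder q 6)) t%4≡1) λ ()) ,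
  λ _ → subst (LocalAdjacencyDim (path t)) (sym (ceil-quotient q 6))
    (localAdjacencyDim-periodic-path q landmarks₁₅ (from-yes (resolvesPathEdges? 6 landmarks₁₅))
       refl (≤ᵇ⇒≤ _ _ _))

localAdjacencyDim-cycle : ∀ t → 4 ≤ t → LocalAdjacencyDim (cycle t) ((t + 3) / 4)
localAdjacencyDim-cycle t 4≤t with residue4 t 4≤t
... | 4q+4 q refl = subst (LocalAdjacencyDim (cycle t)) (sym (ceil-quotient q 3))
  (localAdjacencyDim-periodic-cycle q landmarks₂ (≤ᵇ⇒≤ _ _ _) (from-yes (resolvesPathEdges? 3 landmarks₂))
     refl refl (≤ᵇ⇒≤ _ _ _))
... | 4q+5 q refl = subst (LocalAdjacencyDim (cycle t)) (sym (ceil-quotient q 4))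
  (localAdjacencyDim-periodic-cycle q landmarks₂₃ (≤ᵇ⇒≤ _ _ _) (from-yes (resolvesPathEdges? 4 landmarks₂₃))
     refl refl (≤ᵇ⇒≤ _ _ _))
... | 4q+6 q refl = subst (LocalAdjacencyDim (cycle t)) (sym (ceil-quotient q 5))
  (localAdjacencyDim-periodic-cycle q landmarks₂₄ (≤ᵇ⇒≤ _ _ _) (from-yes (resolvesPathEdges? 5 landmarks₂₄))
     refl refl (≤ᵇ⇒≤ _ _ _))
... | 4q+7 q refl = subst (LocalAdjacencyDim (cycle t)) (sym (ceil-quotient q 6))
  (localAdjacencyDim-periodic-cycle q landmarks₁₅ (≤ᵇ⇒≤ _ _ _) (from-yes (resolvesPathEdges? 6 landmarks₁₅))
     refl refl (≤ᵇ⇒≤ _ _ _))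

mainTheorem10 : (n : ℕ) (G : Adj n) → IsSimple G → Connected G → 2 ≤ n →
    (∀ (t : ℕ) → 2 ≤ t → LocalMetricDim (corona G (complete t)) (n * (t ∸ 1)))
    × (∀ (r s : ℕ) → 1 ≤ r → 1 ≤ s → LocalMetricDim (corona G (completeBip r s)) n)
    × (∀ (t : ℕ) → 4 ≤ t →
         (t % 4 ≡ 1 → LocalMetricDim (corona G (path t)) (n * (t / 4)))
         × (¬ (t % 4 ≡ 1) → LocalMetricDim (corona G (path t)) (n * ((t + 3) / 4))))
    × (∀ (t : ℕ) → 4 ≤ t → LocalMetricDim (corona G (cycle t)) (n * ((t + 3) / 4)))
mainTheorem10 n G simple connected 2≤n =
  (λ { (suc t) (s≤s 1≤t) → corona-of (complete (suc t)) 1≤t (localAdjacencyDim-complete t) }) ,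
  (λ { (suc r) (suc s) _ _ → subst (LocalMetricDim _) (*-identityʳ n)
         (corona-of (completeBip (suc r) (suc s)) ≤-refl (localAdjacencyDim-completeBip r s)) }) ,
  (λ t 4≤t → let t%4≡1⇒dim , t%4≢1⇒dim = localAdjacencyDim-path t 4≤t in
     corona-of (path t) (m≥n⇒m/n>0 4≤t) ∘ t%4≡1⇒dim ,
     corona-of (path t) (⌈t/4⌉>0 t 4≤t) ∘ t%4≢1⇒dim) ,
  λ t 4≤t → corona-of (cycle t) (⌈t/4⌉>0 t 4≤t) (localAdjacencyDim-cycle t 4≤t)
  where
  corona-of : ∀ {m} (H : Adj m) {k} → 1 ≤ k → LocalAdjacencyDim H k → LocalMetricDim (corona G H) (n * k)
  corona-of H = localMetricDim-corona G H simple connected 2≤n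
  ⌈t/4⌉>0 : ∀ t → 4 ≤ t → 1 ≤ (t + 3) / 4
  ⌈t/4⌉>0 t 4≤t = m≥n⇒m/n>0 (≤-trans 4≤t (m≤m+n t 3))
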